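{- Let $d\ge1$ and $1\le r\le 2d$ be integers. There is a constant $C$ depending only on $d$ such that for every integer $n\ge3$ the following holds: if $\omega$ is a monotone dynamo on $\mathbb{T}_n^d$ under reversible $r$-bootstrap percolation, then there exists a dynamo $\omega'$ on $\mathbb{T}_n^d$ under $r$-bootstrap percolation with $|\omega'|\le |\omega|/2+C|\omega|/n$.
   Context: The $d$-dimensional torus $\mathbb{T}_n^d$ is the graph with vertex set $[n]^d=\{1,\dots,n\}^d$, where two vertices are adjacent iff they differ in exactly one coordinate $j$ and in that coordinate $x_j-x'_j\equiv\pm1\pmod n$. A configuration assigns each vertex a state active (1) or inactive (0); $|\omega|$ is the number of active vertices. In $r$-bootstrap percolation, in each round an inactive vertex with at least $r$ active neighbors becomes active and active vertices stay active forever. In reversible $r$-bootstrap percolation, in each round every vertex becomes active if it has at least $r$ active neighbors and inactive otherwise. A dynamo is an initial configuration $\omega^{(0)}$ such that from some time on all vertices are active forever; it is monotone if moreover $\omega^{(t+1)}\ge\omega^{(t)}$ coordinatewise for all $t\ge0$. -}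

module Defs where

open import Data.Nat using (ℕ; zero; suc; _+_; _*_; _≤_; _≤ᵇ_)
open import Data.Nat.DivMod using (_mod_)
open import Data.Fin using (Fin; toℕ; _≟_)
open import Data.Bool using (Bool; true; false; _∨_; if_then_else_)
open import Data.Vec.Functional using (_∷_)
open import Data.Product using (∃; _×_)
open import Relation.Nullary using (does)
open import Relation.Binary.PropositionalEquality using (_≡_)

-- Vertices of the torus T_n^d: functions Fin d → Fin n (coordinates 0..n-1
-- standing for 1..n).
Vertex : ℕ → ℕ → Set
Vertex d n = Fin d → Fin n

Config : ℕ → ℕ → Set
Config d n = Vertex d n → Bool

sucMod : ∀ {n} → Fin n → Fin n
sucMod {suc m} i = suc (toℕ i) mod suc m

predMod : ∀ {n} → Fin n → Fin n
predMod {suc m} i = (toℕ i + m) mod suc m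

setCoord : ∀ {d n} → Vertex d n → Fin d → Fin n → Vertex d n
setCoord x j v = λ k → if does (k ≟ j) then v else x k

sumFin : (m : ℕ) → (Fin m → ℕ) → ℕ
sumFin zero    f = 0
sumFin (suc m) f = f Fin.zero + sumFin m (λ i → f (Fin.suc i))

sumV : (d n : ℕ) → (Vertex d n → ℕ) → ℕ
sumV zero    n f = f (λ ())
sumV (suc d) n f = sumFin n (λ i → sumV d n (λ x → f (i ∷ x)))

b2n : Bool → ℕ
b2n true  = 1
b2n false = 0

size : ∀ {d n} → Config d n → ℕ
size {d} {n} ω = sumV d n (λ x → b2n (ω x))

-- number of active neighbours of x in T_n^d; the neighbours of x are the
-- vertices x ± e_j (j ∈ Fin d), which are 2d distinct vertices when n ≥ 3.
activeNbrs : ∀ {d n} → Config d n → Vertex d n → ℕ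
activeNbrs {d} ω x =
  sumFin d (λ j → b2n (ω (setCoord x j (sucMod (x j))))
                + b2n (ω (setCoord x j (predMod (x j)))))

bootStep : ∀ {d n} → ℕ → Config d n → Config d n
bootStep r ω x = ω x ∨ (r ≤ᵇ activeNbrs ω x)

revStep : ∀ {d n} → ℕ → Config d n → Config d n
revStep r ω x = r ≤ᵇ activeNbrs ω x

iterate : ∀ {A : Set} → (A → A) → ℕ → A → A
iterate f zero    a = a
iterate f (suc t) a = f (iterate f t a)

IsDynamo : ∀ {d n} → (Config d n → Config d n) → Config d n → Set
IsDynamo step ω = ∃ λ T → ∀ t → T ≤ t → ∀ x → iterate step t ω x ≡ true

IsMonotone : ∀ {d n} → (Config d n → Config d n) → Config d n → Set
IsMonotone step ω = ∀ t x → iterate step t ω x ≡ true → iterate step (suc t) ω x ≡ true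

IsMonotoneDynamo : ∀ {d n} → (Config d n → Config d n) → Config d n → Set
IsMonotoneDynamo step ω = IsDynamo step ω × IsMonotone step ω

-- Fix s ∈ [n] and let B_s be the union of the hyperplanes {x_k = s}.  Off B_s
-- the torus is bipartite: a step x_j ↦ x_j ± 1 that does not enter B_s changes
-- (x_j − s) mod n by exactly one, so it flips the parity of Σ_k (x_k − s) mod n.
-- Since ω is a monotone reversible dynamo, every vertex of ω has at least r
-- neighbours in ω.  Keep from ω only the vertices in B_s or of parity b: a
-- dropped vertex of ω has all its neighbours in ω kept, so one bootstrap round
-- restores ω, after which bootstrap dominates the reversible dynamics.  The two
-- choices of b have sizes summing to |ω| + |ω ∩ B_s|, and since every vertex
-- lies in at most d of the sets B_s, some s has n |ω ∩ B_s| ≤ d |ω|.  Hence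
-- C = d works.
module Submission where

open import Defs
open import Data.Nat using (ℕ; zero; suc; _+_; _*_; _∸_; _≤_; _<_; _≤ᵇ_; z≤n; s≤s; _≤?_; NonZero)
open import Data.Nat.Properties hiding (_≟_; suc-injective)
open import Data.Nat.DivMod using (_%_; %-distribˡ-+; m%n%n≡m%n; [m+n]%n≡m%n; m<n⇒m%n≡m; m≤n⇒m%n≡m; n%n≡0)
open import Algebra.Properties.Semiring.Sum +-*-semiring using (sum; ∑-distrib-+; ∑-comm; *-distribˡ-sum)
open import Data.Fin using (Fin; toℕ; _≟_)
open import Data.Fin.Properties using (toℕ-injective; toℕ<n; toℕ-fromℕ<; any?; suc-injective)
open import Data.Vec.Functional using (_∷_)
open import Data.Bool using (Bool; true; false; _∧_; _∨_; not)
import Data.Bool.Properties as Bool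
open import Data.Product using (∃; _×_; _,_)
open import Data.Sum using (_⊎_; inj₁; inj₂)
import Data.Sum as Sum
open import Data.Empty using (⊥-elim)
open import Function using (_∘_; Equivalence)
open import Relation.Nullary using (yes; no; does)
open import Relation.Nullary.Decidable using (dec-true)
open import Relation.Binary.PropositionalEquality

private
  variable
    d n m : ℕ

sumFin≡sum : (f : Fin m → ℕ) → sumFin m f ≡ sum f
sumFin≡sum {zero}  f = refl
sumFin≡sum {suc m} f = cong (f Fin.zero +_) (sumFin≡sum (f ∘ Fin.suc))

sumFin-cong : {f g : Fin m → ℕ} → f ≗ g → sumFin m f ≡ sumFin m g
sumFin-cong {zero}  f≗g = refl
sumFin-cong {suc m} f≗g = cong₂ _+_ (f≗g Fin.zero) (sumFin-cong (f≗g ∘ Fin.suc))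

sumFin-mono : {f g : Fin m → ℕ} → (∀ i → f i ≤ g i) → sumFin m f ≤ sumFin m g
sumFin-mono {zero}  f≤g = z≤n
sumFin-mono {suc m} f≤g = +-mono-≤ (f≤g Fin.zero) (sumFin-mono (f≤g ∘ Fin.suc))

sumFin-const : ∀ m c → sumFin m (λ _ → c) ≡ m * c
sumFin-const zero    c = refl
sumFin-const (suc m) c = cong (c +_) (sumFin-const m c)

sumFin-distrib-+ : ∀ m (f g : Fin m → ℕ) → sumFin m (λ i → f i + g i) ≡ sumFin m f + sumFin m g
sumFin-distrib-+ m f g = begin
  sumFin m (λ i → f i + g i) ≡⟨ sumFin≡sum (λ i → f i + g i) ⟩
  sum (λ i → f i + g i)      ≡⟨ ∑-distrib-+ f g ⟩
  sum f + sum g              ≡⟨ cong₂ _+_ (sumFin≡sum f) (sumFin≡sum g) ⟨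
  sumFin m f + sumFin m g    ∎
  where open ≡-Reasoning

*-distribˡ-sumFin : ∀ m c (f : Fin m → ℕ) → c * sumFin m f ≡ sumFin m (λ i → c * f i)
*-distribˡ-sumFin m c f = begin
  c * sumFin m f             ≡⟨ cong (c *_) (sumFin≡sum f) ⟩
  c * sum f                  ≡⟨ *-distribˡ-sum c f ⟩
  sum (λ i → c * f i)        ≡⟨ sumFin≡sum (λ i → c * f i) ⟨
  sumFin m (λ i → c * f i)   ∎
  where open ≡-Reasoning

sumFin-comm : ∀ m k (f : Fin m → Fin k → ℕ) →
              sumFin m (λ i → sumFin k (f i)) ≡ sumFin k (λ j → sumFin m (λ i → f i j))
sumFin-comm m k f = begin
  sumFin m (λ i → sumFin k (f i))           ≡⟨ sumFin²≡sum² f ⟩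
  sum (λ i → sum (f i))                     ≡⟨ ∑-comm f ⟩
  sum (λ j → sum (λ i → f i j))             ≡⟨ sumFin²≡sum² (λ j i → f i j) ⟨
  sumFin k (λ j → sumFin m (λ i → f i j))   ∎
  where
  open ≡-Reasoning
  sumFin²≡sum² : ∀ {a b} (g : Fin a → Fin b → ℕ) → sumFin a (λ i → sumFin b (g i)) ≡ sum (λ i → sum (g i))
  sumFin²≡sum² g = trans (sumFin-cong (sumFin≡sum ∘ g)) (sumFin≡sum (λ i → sum (g i)))

sumFin-suc-at : {f g : Fin m → ℕ} (j : Fin m) → (∀ i → i ≢ j → f i ≡ g i) →
                g j ≡ suc (f j) → sumFin m g ≡ suc (sumFin m f)
sumFin-suc-at {suc m} Fin.zero    f≡g gj≡1+fj =
  cong₂ _+_ gj≡1+fj (sumFin-cong (λ i → sym (f≡g (Fin.suc i) (λ ()))))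
sumFin-suc-at {suc m} (Fin.suc j) f≡g gj≡1+fj =
  trans (cong₂ _+_ (sym (f≡g Fin.zero (λ ())))
                   (sumFin-suc-at j (λ i i≢j → f≡g (Fin.suc i) (i≢j ∘ suc-injective)) gj≡1+fj))
        (+-suc _ _)

term≤sumFin : (f : Fin m → ℕ) (i : Fin m) → f i ≤ sumFin m f
term≤sumFin f Fin.zero    = m≤m+n _ _
term≤sumFin f (Fin.suc i) = ≤-trans (term≤sumFin (f ∘ Fin.suc) i) (m≤n+m _ _)

sumFin-indicator : (v : Fin m) → sumFin m (λ s → b2n (does (v ≟ s))) ≡ 1
sumFin-indicator {suc m} Fin.zero    = cong suc (trans (sumFin-const m 0) (*-zeroʳ m))
sumFin-indicator {suc m} (Fin.suc v) = sumFin-indicator v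

sumV-cong : {f g : Vertex d n → ℕ} → f ≗ g → sumV d n f ≡ sumV d n g
sumV-cong {zero}  f≗g = f≗g _
sumV-cong {suc d} f≗g = sumFin-cong (λ i → sumV-cong (λ x → f≗g (i ∷ x)))

sumV-mono : {f g : Vertex d n → ℕ} → (∀ x → f x ≤ g x) → sumV d n f ≤ sumV d n g
sumV-mono {zero}  f≤g = f≤g _
sumV-mono {suc d} f≤g = sumFin-mono (λ i → sumV-mono (λ x → f≤g (i ∷ x)))

sumV-distrib-+ : (f g : Vertex d n → ℕ) → sumV d n (λ x → f x + g x) ≡ sumV d n f + sumV d n g
sumV-distrib-+ {zero}  f g = refl
sumV-distrib-+ {suc d} {n} f g = trans (sumFin-cong (λ i → sumV-distrib-+ (f ∘ (i ∷_)) (g ∘ (i ∷_)))) (sumFin-distrib-+ n _ _)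

*-distribˡ-sumV : ∀ c (f : Vertex d n → ℕ) → c * sumV d n f ≡ sumV d n (λ x → c * f x)
*-distribˡ-sumV {zero}  c f = refl
*-distribˡ-sumV {suc d} {n} c f = trans (*-distribˡ-sumFin n c _) (sumFin-cong (λ i → *-distribˡ-sumV c (f ∘ (i ∷_))))

sumV-sumFin-comm : (f : Vertex d n → Fin m → ℕ) →
                   sumV d n (λ x → sumFin m (f x)) ≡ sumFin m (λ s → sumV d n (λ x → f x s))
sumV-sumFin-comm {zero}  f = refl
sumV-sumFin-comm {suc d} {n} {m} f = trans (sumFin-cong (λ i → sumV-sumFin-comm (f ∘ (i ∷_)))) (sumFin-comm n m _)

∃-below-average : (f : Fin (suc m) → ℕ) → ∃ λ s → suc m * f s ≤ sumFin (suc m) f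
∃-below-average {zero}  f = Fin.zero , ≤-refl
∃-below-average {suc m} f with ∃-below-average (f ∘ Fin.suc)
... | s , h with f Fin.zero ≤? f (Fin.suc s)
...   | yes f0≤fs = Fin.zero , +-monoʳ-≤ (f Fin.zero) (≤-trans (*-monoʳ-≤ (suc m) f0≤fs) h)
...   | no  f0≰fs = Fin.suc s , +-mono-≤ (<⇒≤ (≰⇒> f0≰fs)) h

∃-below-half : (f : Bool → ℕ) → ∃ λ b → 2 * f b ≤ f false + f true
∃-below-half f with f false ≤? f true
... | yes f≤t = false , +-monoʳ-≤ (f false) (≤-trans (≤-reflexive (+-identityʳ _)) f≤t)
... | no  f≰t = true  , +-mono-≤ (<⇒≤ (≰⇒> f≰t)) (≤-reflexive (+-identityʳ _))

offsetℕ : ℕ → ℕ → ℕ → ℕ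
offsetℕ n c a with c ≤? a
... | yes _ = a ∸ c
... | no  _ = a + n ∸ c

offsetℕ-suc : ∀ {c a} → c < n → suc a ≢ c → offsetℕ n c (suc a) ≡ suc (offsetℕ n c a)
offsetℕ-suc {n} {c} {a} c<n 1+a≢c with c ≤? a | c ≤? suc a
... | yes c≤a | yes _      = +-∸-assoc 1 c≤a
... | yes c≤a | no  c≰1+a  = ⊥-elim (c≰1+a (m≤n⇒m≤1+n c≤a))
... | no  c≰a | yes c≤1+a  = ⊥-elim (c≰a (m<1+n⇒m≤n (≤∧≢⇒< c≤1+a (1+a≢c ∘ sym))))
... | no  _   | no  _      = +-∸-assoc 1 (≤-trans (<⇒≤ c<n) (m≤n+m n a))

offsetℕ-wrap : ∀ {c} → c ≤ m → c ≢ 0 → offsetℕ (suc m) c 0 ≡ suc (offsetℕ (suc m) c m)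
offsetℕ-wrap {m} {c} c≤m c≢0 with c ≤? 0 | c ≤? m
... | yes c≤0 | _      = ⊥-elim (c≢0 (n≤0⇒n≡0 c≤0))
... | no  _   | yes _  = +-∸-assoc 1 c≤m
... | no  _   | no c≰m = ⊥-elim (c≰m c≤m)

offset : Fin n → Fin n → ℕ
offset {n} s v = offsetℕ n (toℕ s) (toℕ v)

toℕ-sucMod : (v : Fin (suc m)) → toℕ (sucMod v) ≡ suc (toℕ v) ⊎ (toℕ v ≡ m × toℕ (sucMod v) ≡ 0)
toℕ-sucMod {m} v with suc (toℕ v) ≤? m
... | yes v<m = inj₁ (trans (toℕ-fromℕ< _) (m≤n⇒m%n≡m v<m))
... | no  v≮m = inj₂ (v≡m , trans (toℕ-fromℕ< _) (trans (cong (λ k → suc k % suc m) v≡m) (n%n≡0 (suc m))))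
  where
  v≡m : toℕ v ≡ m
  v≡m = ≤-antisym (≤-pred (toℕ<n v)) (≮⇒≥ v≮m)

[1+m%n]%n≡[1+m]%n : ∀ a n .{{_ : NonZero n}} → suc (a % n) % n ≡ suc a % n
[1+m%n]%n≡[1+m]%n a n = begin
  (1 + a % n) % n          ≡⟨ %-distribˡ-+ 1 (a % n) n ⟩
  (1 % n + a % n % n) % n  ≡⟨ cong (λ k → (1 % n + k) % n) (m%n%n≡m%n a n) ⟩
  (1 % n + a % n) % n      ≡⟨ %-distribˡ-+ 1 a n ⟨
  (1 + a) % n              ∎
  where open ≡-Reasoning

sucMod-predMod : (v : Fin n) → sucMod (predMod v) ≡ v
sucMod-predMod {suc m} v = toℕ-injective (begin
  toℕ (sucMod (predMod v))              ≡⟨ toℕ-fromℕ< _ ⟩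
  suc (toℕ (predMod v)) % suc m         ≡⟨ cong (λ k → suc k % suc m) (toℕ-fromℕ< _) ⟩
  suc ((toℕ v + m) % suc m) % suc m     ≡⟨ [1+m%n]%n≡[1+m]%n (toℕ v + m) (suc m) ⟩
  suc (toℕ v + m) % suc m               ≡⟨ cong (_% suc m) (+-suc (toℕ v) m) ⟨
  (toℕ v + suc m) % suc m               ≡⟨ [m+n]%n≡m%n (toℕ v) (suc m) ⟩
  toℕ v % suc m                         ≡⟨ m<n⇒m%n≡m (toℕ<n v) ⟩
  toℕ v                                 ∎)
  where open ≡-Reasoning

offset-sucMod : {s v : Fin n} → sucMod v ≢ s → offset s (sucMod v) ≡ suc (offset s v)
offset-sucMod {suc m} {s} {v} v+1≢s with toℕ-sucMod v
... | inj₁ e = trans (cong (offsetℕ (suc m) (toℕ s)) e)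
                     (offsetℕ-suc (toℕ<n s) (v+1≢s ∘ toℕ-injective ∘ trans e))
... | inj₂ (v≡m , e) = trans (cong (offsetℕ (suc m) (toℕ s)) e)
                             (trans (offsetℕ-wrap (≤-pred (toℕ<n s)) (v+1≢s ∘ toℕ-injective ∘ trans e ∘ sym))
                                    (cong (suc ∘ offsetℕ (suc m) (toℕ s)) (sym v≡m)))

offset-predMod : {s v : Fin n} → v ≢ s → offset s v ≡ suc (offset s (predMod v))
offset-predMod {s = s} {v} v≢s =
  subst (λ u → offset s u ≡ suc (offset s (predMod v))) (sucMod-predMod v)
        (offset-sucMod (v≢s ∘ trans (sym (sucMod-predMod v))))

data Adjacent {d n} (x : Vertex d n) : Vertex d n → Set where
  up   : ∀ j → Adjacent x (setCoord x j (sucMod (x j)))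
  down : ∀ j → Adjacent x (setCoord x j (predMod (x j)))

setCoord-same : (x : Vertex d n) (j : Fin d) (w : Fin n) → setCoord x j w j ≡ w
setCoord-same x j w with j ≟ j
... | yes _   = refl
... | no  j≢j = ⊥-elim (j≢j refl)

setCoord-other : (x : Vertex d n) {j : Fin d} (w : Fin n) {k : Fin d} → k ≢ j → setCoord x j w k ≡ x k
setCoord-other x {j} w {k} k≢j with k ≟ j
... | yes k≡j = ⊥-elim (k≢j k≡j)
... | no  _   = refl

Avoids : Fin n → Vertex d n → Set
Avoids s x = ∀ k → x k ≢ s

meets : Fin n → Vertex d n → Bool
meets s x = does (any? λ k → x k ≟ s)

meets-false : {s : Fin n} {x : Vertex d n} → meets s x ≡ false → Avoids s x
meets-false {s = s} {x} x∉ k xk≡s with any? (λ k → x k ≟ s)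
... | no ¬∃ = ¬∃ (k , xk≡s)

meets≤hits : (s : Fin n) (x : Vertex d n) → b2n (meets s x) ≤ sumFin d (λ k → b2n (does (x k ≟ s)))
meets≤hits {d = d} s x with any? (λ k → x k ≟ s)
... | no  _          = z≤n
... | yes (k , xk≡s) = ≤-trans (≤-reflexive (cong b2n (sym (dec-true (x k ≟ s) xk≡s))))
                               (term≤sumFin (λ k → b2n (does (x k ≟ s))) k)

sumFin-meets≤ : (x : Vertex d n) → sumFin n (λ s → b2n (meets s x)) ≤ d
sumFin-meets≤ {d} {n} x = begin
  sumFin n (λ s → b2n (meets s x))                         ≤⟨ sumFin-mono (λ s → meets≤hits s x) ⟩
  sumFin n (λ s → sumFin d (λ k → b2n (does (x k ≟ s))))  ≡⟨ sumFin-comm n d _ ⟩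
  sumFin d (λ k → sumFin n (λ s → b2n (does (x k ≟ s))))  ≡⟨ sumFin-cong (sumFin-indicator ∘ x) ⟩
  sumFin d (λ _ → 1)                                       ≡⟨ sumFin-const d 1 ⟩
  d * 1                                                    ≡⟨ *-identityʳ d ⟩
  d                                                        ∎
  where open ≤-Reasoning

even : ℕ → Bool
even zero    = true
even (suc k) = not (even k)

parity : Fin n → Vertex d n → Bool
parity {d = d} s x = even (sumFin d (λ k → offset s (x k)))

even-sumFin-adjacent : {f g : Fin m → ℕ} (j : Fin m) → (∀ i → i ≢ j → f i ≡ g i) →
                       g j ≡ suc (f j) ⊎ f j ≡ suc (g j) → even (sumFin m g) ≡ not (even (sumFin m f))
even-sumFin-adjacent j f≡g (inj₁ g=f+1) = cong even (sumFin-suc-at j f≡g g=f+1)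
even-sumFin-adjacent j f≡g (inj₂ f=g+1) =
  trans (sym (Bool.not-involutive _)) (cong not (sym (cong even (sumFin-suc-at j (λ i i≢j → sym (f≡g i i≢j)) f=g+1))))

parity-setCoord : (s : Fin n) (x : Vertex d n) (j : Fin d) {w : Fin n} →
                  offset s w ≡ suc (offset s (x j)) ⊎ offset s (x j) ≡ suc (offset s w) →
                  parity s (setCoord x j w) ≡ not (parity s x)
parity-setCoord s x j {w} step =
  even-sumFin-adjacent j (λ k k≢j → cong (offset s) (sym (setCoord-other x w k≢j)))
    (Sum.map (trans (cong (offset s) (setCoord-same x j w)))
             (λ e → trans e (cong (suc ∘ offset s) (sym (setCoord-same x j w)))) step)

parity-adjacent : {s : Fin n} {x y : Vertex d n} → Avoids s x → Avoids s y → Adjacent x y →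
                  parity s y ≡ not (parity s x)
parity-adjacent {s = s} {x} x∌s y∌s (up j) =
  parity-setCoord s x j (inj₁ (offset-sucMod (y∌s j ∘ trans (setCoord-same x j _))))
parity-adjacent {s = s} {x} x∌s y∌s (down j) =
  parity-setCoord s x j (inj₂ (offset-predMod (x∌s j)))

_⊆_ : Config d n → Config d n → Set
η ⊆ η′ = ∀ x → η x ≡ true → η′ x ≡ true

_∩_ : Config d n → Config d n → Config d n
(η ∩ η′) x = η x ∧ η′ x

b2n-mono : {a b : Bool} → (a ≡ true → b ≡ true) → b2n a ≤ b2n b
b2n-mono {false} _   = z≤n
b2n-mono {true}  a⇒b = ≤-reflexive (cong b2n (sym (a⇒b refl)))

activeNbrs-mono : {η η′ : Config d n} {x : Vertex d n} →
                  (∀ {y} → Adjacent x y → η y ≡ true → η′ y ≡ true) → activeNbrs η x ≤ activeNbrs η′ x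
activeNbrs-mono η⊆η′ = sumFin-mono (λ j → +-mono-≤ (b2n-mono (η⊆η′ (up j))) (b2n-mono (η⊆η′ (down j))))

≤ᵇ-true⇒≤ : ∀ {a b} → (a ≤ᵇ b) ≡ true → a ≤ b
≤ᵇ-true⇒≤ e = ≤ᵇ⇒≤ _ _ (Equivalence.from Bool.T-≡ e)

bootStep-threshold : ∀ r (η : Config d n) x → r ≤ activeNbrs η x → bootStep r η x ≡ true
bootStep-threshold r η x r≤a = trans (cong (η x ∨_) (Equivalence.to Bool.T-≡ (≤⇒≤ᵇ r≤a))) (Bool.∨-zeroʳ _)

bootStep-active : ∀ {r} {η : Config d n} → η ⊆ bootStep r η
bootStep-active {r = r} {η} x e = cong (_∨ (r ≤ᵇ activeNbrs η x)) e

revStep⊆bootStep : ∀ {r} {η η′ : Config d n} → η ⊆ η′ → revStep r η ⊆ bootStep r η′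
revStep⊆bootStep {r = r} {η} {η′} η⊆η′ x e =
  bootStep-threshold r η′ x (≤-trans (≤ᵇ-true⇒≤ e) (activeNbrs-mono (λ {y} _ → η⊆η′ y)))

isDynamo-transfer : ∀ {r} {ω ω′ : Config d n} →
                    IsDynamo (revStep r) ω → ω ⊆ bootStep r ω′ → IsDynamo (bootStep r) ω′
isDynamo-transfer {r = r} {ω} {ω′} (T , active) ω⊆ = suc T , λ { (suc t) (s≤s T≤t) x → dominated t x (active t T≤t x) }
  where
  dominated : ∀ t → iterate (revStep r) t ω ⊆ iterate (bootStep r) (suc t) ω′
  dominated zero    = ω⊆
  dominated (suc t) = revStep⊆bootStep {r = r} (dominated t)

kept : Bool → Fin n → Config d n
kept b s x = meets s x ∨ does (parity s x Bool.≟ b)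

thin : Bool → Fin n → Config d n → Config d n
thin b s ω = ω ∩ kept b s

kept-adjacent : ∀ {b} {s : Fin n} {x y : Vertex d n} → kept b s x ≡ false → Adjacent x y → kept b s y ≡ true
kept-adjacent {b = b} {s} {x} {y} x∉ x─y with meets s x in x∌s | meets s y in y∌s
... | false | true  = refl
... | false | false with parity s x Bool.≟ b
...   | no px≢b = dec-true (parity s y Bool.≟ b)
                    (trans (parity-adjacent (meets-false x∌s) (meets-false y∌s) x─y) (sym (Bool.¬-not (px≢b ∘ sym))))

thin-spans : ∀ {r} b (s : Fin n) {ω : Config d n} → ω ⊆ revStep r ω → ω ⊆ bootStep r (thin b s ω)
thin-spans {r = r} b s {ω} ω⊆rev x ωx = by-cases (kept b s x) refl
  where
  by-cases : ∀ k → kept b s x ≡ k → bootStep r (thin b s ω) x ≡ true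
  by-cases true  kx = bootStep-active {r = r} {thin b s ω} x (cong₂ _∧_ ωx kx)
  by-cases false kx = bootStep-threshold r (thin b s ω) x (≤-trans (≤ᵇ-true⇒≤ (ω⊆rev x ωx))
    (activeNbrs-mono {η = ω} {thin b s ω} (λ {y} x─y ωy → cong₂ _∧_ ωy (kept-adjacent {b = b} {s} {x} {y} kx x─y))))

thin-isDynamo : ∀ {r} b (s : Fin n) {ω : Config d n} →
                IsMonotoneDynamo (revStep r) ω → IsDynamo (bootStep r) (thin b s ω)
thin-isDynamo {r = r} b s (dynamo , monotone) = isDynamo-transfer {r = r} dynamo (thin-spans {r = r} b s (monotone 0))

b2n-split : ∀ a c p → b2n (a ∧ (c ∨ does (p Bool.≟ false))) + b2n (a ∧ (c ∨ does (p Bool.≟ true))) ≡ b2n a + b2n (a ∧ c)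
b2n-split false c     p     = refl
b2n-split true  true  p     = refl
b2n-split true  false false = refl
b2n-split true  false true  = refl

size-thin-split : (s : Fin n) (ω : Config d n) →
                  size (thin false s ω) + size (thin true s ω) ≡ size ω + size (ω ∩ meets s)
size-thin-split {n} {d} s ω = begin
  size (thin false s ω) + size (thin true s ω)  ≡⟨ sumV-distrib-+ (b2n ∘ thin false s ω) (b2n ∘ thin true s ω) ⟨
  sumV d n (λ x → b2n (thin false s ω x) + b2n (thin true s ω x))
    ≡⟨ sumV-cong (λ x → b2n-split (ω x) (meets s x) (parity s x)) ⟩
  sumV d n (λ x → b2n (ω x) + b2n ((ω ∩ meets s) x))  ≡⟨ sumV-distrib-+ (b2n ∘ ω) (b2n ∘ (ω ∩ meets s)) ⟩
  size ω + size (ω ∩ meets s)                         ∎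
  where open ≡-Reasoning

sumFin-meets-active≤ : ∀ a (x : Vertex d n) → sumFin n (λ s → b2n (a ∧ meets s x)) ≤ d * b2n a
sumFin-meets-active≤ {d} {n} false x = ≤-trans (≤-reflexive (trans (sumFin-const n 0) (*-zeroʳ n))) z≤n
sumFin-meets-active≤ {d} true x = ≤-trans (sumFin-meets≤ x) (≤-reflexive (sym (*-identityʳ d)))

sumFin-size-meets≤ : (ω : Config d n) → sumFin n (λ s → size (ω ∩ meets s)) ≤ d * size ω
sumFin-size-meets≤ {d} {n} ω = begin
  sumFin n (λ s → size (ω ∩ meets s))                         ≡⟨ sumV-sumFin-comm (λ x s → b2n (ω x ∧ meets s x)) ⟨
  sumV d n (λ x → sumFin n (λ s → b2n (ω x ∧ meets s x)))  ≤⟨ sumV-mono (λ x → sumFin-meets-active≤ (ω x) x) ⟩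
  sumV d n (λ x → d * b2n (ω x))                             ≡⟨ *-distribˡ-sumV d (b2n ∘ ω) ⟨
  d * size ω                                                  ∎
  where open ≤-Reasoning

half-plus-fraction : ∀ n d S K M → 2 * M ≤ S + K → n * K ≤ d * S → 2 * n * M ≤ n * S + 2 * d * S
half-plus-fraction n d S K M 2M≤S+K nK≤dS = begin
  2 * n * M      ≡⟨ cong (_* M) (*-comm 2 n) ⟩
  n * 2 * M      ≡⟨ *-assoc n 2 M ⟩
  n * (2 * M)    ≤⟨ *-monoʳ-≤ n 2M≤S+K ⟩
  n * (S + K)    ≡⟨ *-distribˡ-+ n S K ⟩
  n * S + n * K  ≤⟨ +-monoʳ-≤ (n * S) nK≤dS ⟩
  n * S + d * S  ≤⟨ +-monoʳ-≤ (n * S) (*-monoˡ-≤ S (m≤m+n d (d + 0))) ⟩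
  n * S + 2 * d * S ∎
  where open ≤-Reasoning

lemma3 : ∀ (d : ℕ) → 1 ≤ d → ∃ λ (C : ℕ) →
             ∀ (r : ℕ) → 1 ≤ r → r ≤ 2 * d → ∀ (n : ℕ) → 3 ≤ n →
             ∀ (ω : Config d n) → IsMonotoneDynamo (revStep r) ω →
             ∃ λ (ω′ : Config d n) → IsDynamo (bootStep r) ω′ ×
               2 * n * size ω′ ≤ n * size ω + 2 * C * size ω
lemma3 d _ = d , λ where
  r _ _ (suc m) (s≤s _) ω monotoneDynamo →
    let (s , n·K≤ΣK) = ∃-below-average (λ s → size (ω ∩ meets s))
        (b , 2M≤S+K) = ∃-below-half (λ b → size (thin b s ω))
    in thin b s ω , thin-isDynamo {r = r} b s monotoneDynamo ,
       half-plus-fraction (suc m) d (size ω) (size (ω ∩ meets s)) (size (thin b s ω))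
         (≤-trans 2M≤S+K (≤-reflexive (size-thin-split s ω)))
         (≤-trans n·K≤ΣK (sumFin-size-meets≤ ω))
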